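{- Let $q$ be even and let $O_1,O_2$ be two ovoids of $\mathrm{PG}(3,q)$. For $i\in\{1,2\}$ let $Q_i$ be the symplectic generalized quadrangle associated to $O_i$, whose points are the points of $\mathrm{PG}(3,q)$ and whose lines are the lines of $\mathrm{PG}(3,q)$ meeting $O_i$ in exactly one point; its lines are exactly the lines totally isotropic with respect to a symplectic polarity $\zeta_i$ of $\mathrm{PG}(3,q)$. Then the following are equivalent: (1) $\zeta_1=\zeta_2$; (2) $Q_1=Q_2$; (3) $O_1$ is an ovoid of $Q_2$; (4) $O_2$ is an ovoid of $Q_1$.
   Context: An ovoid of $\mathrm{PG}(3,q)$ is a set of $q^2+1$ points meeting every plane in one point or in an oval. An ovoid of a generalized quadrangle $Q_i$ is a set of points meeting every line of $Q_i$ in exactly one point. -}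

module Defs where

open import Level using (Level; _⊔_)
open import Algebra.Bundles using (CommutativeRing)
open import Data.Nat as ℕ using (ℕ)
open import Data.Fin using (Fin; zero; suc)
open import Data.Product using (Σ; ∃; _×_; _,_)
open import Data.Sum using (_⊎_)
open import Relation.Nullary using (¬_)
open import Relation.Binary.PropositionalEquality using (_≡_)
open import Function.Bundles using (_⇔_)

-- Everything is parametrised by a commutative ring R (which will be
-- required to be a finite field of order q).
module PG {c ℓ : Level} (R : CommutativeRing c ℓ) where
  open CommutativeRing R using (Carrier; _≈_; _+_; _*_; 0#; 1#)

  IsField : Set (c ⊔ ℓ)
  IsField = (¬ (0# ≈ 1#)) × (∀ x → ¬ (x ≈ 0#) → ∃ λ y → x * y ≈ 1#)

  HasOrder : ℕ → Set (c ⊔ ℓ)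
  HasOrder q = Σ (Fin q → Carrier) λ e →
    (∀ i j → e i ≈ e j → i ≡ j) × (∀ x → ∃ λ i → e i ≈ x)

  V : Set c
  V = Fin 4 → Carrier

  i0 i1 i2 i3 : Fin 4
  i0 = zero
  i1 = suc zero
  i2 = suc (suc zero)
  i3 = suc (suc (suc zero))

  sum4 : (Fin 4 → Carrier) → Carrier
  sum4 f = f i0 + f i1 + f i2 + f i3

  dot : V → V → Carrier
  dot a x = sum4 (λ i → a i * x i)

  -- a vector represents a point of PG(3,q) iff it is nonzero
  IsPoint : V → Set ℓ
  IsPoint x = ¬ (∀ i → x i ≈ 0#)

  -- two vectors represent the same projective point
  _∼_ : V → V → Set (c ⊔ ℓ)
  x ∼ y = ∃ λ λ' → (¬ (λ' ≈ 0#)) × (∀ i → x i ≈ λ' * y i)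

  -- a set of points of PG(3,q): a predicate on vectors, closed under ∼
  PointSet : Set (Level.suc (c ⊔ ℓ))
  PointSet = V → Set (c ⊔ ℓ)

  RespectsProj : PointSet → Set (c ⊔ ℓ)
  RespectsProj S = ∀ x y → x ∼ y → S x → S y

  HasSize : PointSet → ℕ → Set (c ⊔ ℓ)
  HasSize S n = Σ (Fin n → V) λ p →
      (∀ i → IsPoint (p i) × S (p i))
    × (∀ i j → p i ∼ p j → i ≡ j)
    × (∀ x → IsPoint x → S x → ∃ λ i → x ∼ p i)

  _∩_ : PointSet → PointSet → PointSet
  (S ∩ T) x = S x × T x

  OnPlane : V → PointSet
  OnPlane a x = Level.Lift c (dot a x ≈ 0#)

  Collinear : V → V → V → Set (c ⊔ ℓ)
  Collinear u v w = ∃ λ a → ∃ λ b → ∃ λ d →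
      (¬ ((a ≈ 0#) × (b ≈ 0#) × (d ≈ 0#)))
    × (∀ i → a * u i + b * v i + d * w i ≈ 0#)

  Distinct : V → V → Set (c ⊔ ℓ)
  Distinct u v = IsPoint u × IsPoint v × ¬ (u ∼ v)

  OnLine : V → V → PointSet
  OnLine u v x = Collinear u v x

  NoThreeCollinear : PointSet → Set (c ⊔ ℓ)
  NoThreeCollinear S = ∀ x y z → S x → S y → S z →
    Distinct x y → Distinct y z → Distinct x z → ¬ Collinear x y z

  IsOval : ℕ → PointSet → Set (c ⊔ ℓ)
  IsOval q S = HasSize S (q ℕ.+ 1) × NoThreeCollinear S

  IsOvoidPG : ℕ → PointSet → Set (c ⊔ ℓ)
  IsOvoidPG q O = HasSize O (q ℕ.^ 2 ℕ.+ 1)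
    × (∀ a → IsPoint a → HasSize (O ∩ OnPlane a) 1 ⊎ IsOval q (O ∩ OnPlane a))

  IsLineOfQ : PointSet → V → V → Set (c ⊔ ℓ)
  IsLineOfQ O u v = HasSize (O ∩ OnLine u v) 1

  -- Q(O1) = Q(O2): both have all points of PG(3,q); same set of lines
  SameGQ : PointSet → PointSet → Set (c ⊔ ℓ)
  SameGQ O₁ O₂ = ∀ u v → Distinct u v → (IsLineOfQ O₁ u v ⇔ IsLineOfQ O₂ u v)

  IsOvoidOfGQ : PointSet → PointSet → Set (c ⊔ ℓ)
  IsOvoidOfGQ S O = ∀ u v → Distinct u v → IsLineOfQ O u v →
    HasSize (S ∩ OnLine u v) 1

  Mat : Set c
  Mat = Fin 4 → Fin 4 → Carrier

  Form : (Fin 4 → Fin 4 → Carrier) → V → V → Carrier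
  Form M x y = sum4 (λ i → sum4 (λ j → x i * M i j * y j))

  IsSymplectic : (Fin 4 → Fin 4 → Carrier) → Set (c ⊔ ℓ)
  IsSymplectic M = (∀ x → Form M x x ≈ 0#)
    × (∀ x → IsPoint x → ¬ (∀ y → Form M x y ≈ 0#))

  -- the polarity x ↦ x^ζ = {y | B(x,y) = 0}; equality of polarities
  SamePolarity : (Fin 4 → Fin 4 → Carrier) → (Fin 4 → Fin 4 → Carrier) → Set (c ⊔ ℓ)
  SamePolarity M₁ M₂ = ∀ x y → IsPoint x → IsPoint y →
    (Form M₁ x y ≈ 0# ⇔ Form M₂ x y ≈ 0#)

  PolarityOf : (Fin 4 → Fin 4 → Carrier) → PointSet → Set (c ⊔ ℓ)
  PolarityOf M O = ∀ u v → Distinct u v → (Form M u v ≈ 0# ⇔ IsLineOfQ O u v)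

-- Unfolding the definitions, O₁ is an ovoid of Q₂ iff every line of Q₂ is a line of Q₁,
-- i.e. iff every ζ₂-totally isotropic line is ζ₁-totally isotropic. For a point x this says
-- x^ζ₂ ⊆ x^ζ₁, and as x^ζ₂ is the kernel of a linear form while x^ζ₁ is a proper subspace,
-- the two coincide: ζ₁ = ζ₂. Evenness of q and the ovoid axioms only matter for the existence of
-- the polarities ζᵢ, which is assumed; finiteness of the field makes its equality decidable.
module Submission where

open import Defs
open import Level using (Level)
open import Algebra.Bundles using (CommutativeRing)
open import Data.Nat using (ℕ)
open import Data.Nat.Divisibility using (_∣_)
open import Data.Product using (_×_; _,_; proj₁; proj₂)
open import Function.Bundles using (_⇔_; mk⇔; Equivalence)
open import Function.Construct.Symmetry using (⇔-sym)

open import Data.Maybe using (nothing)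
open import Function using (_∘_)
import Data.Fin.Properties as Fin
open import Relation.Nullary using (¬_; yes; no)
open import Relation.Nullary.Decidable using (decidable-stable)
open import Relation.Binary.Definitions using (Decidable)
open import Relation.Binary.PropositionalEquality using (cong)
import Tactic.RingSolver.Core.AlmostCommutativeRing as ACR

module _ {c ℓ : Level} (R : CommutativeRing c ℓ) where
  open CommutativeRing R
  open PG R
  open import Algebra.Properties.Ring ring using (-‿distribˡ-*)
  open import Algebra.Properties.CommutativeSemigroup *-commutativeSemigroup using (x∙yz≈y∙xz)
  open import Relation.Binary.Reasoning.Setoid setoid
  open import Tactic.RingSolver.NonReflective (ACR.fromCommutativeRing R (λ _ → nothing))

  hasOrder⇒≈-dec : ∀ {q} → HasOrder q → Decidable _≈_
  hasOrder⇒≈-dec (e , inj , surj) x y with surj x | surj y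
  ... | i , eᵢ≈x | j , eⱼ≈y with i Fin.≟ j
  ... | yes i≡j = yes (trans (sym eᵢ≈x) (trans (reflexive (cong e i≡j)) eⱼ≈y))
  ... | no i≢j = no (λ x≈y → i≢j (inj i j (trans eᵢ≈x (trans x≈y (sym eⱼ≈y)))))

  sum4-cong : ∀ {f g} → (∀ i → f i ≈ g i) → sum4 f ≈ sum4 g
  sum4-cong f≈g = +-cong (+-cong (+-cong (f≈g i0) (f≈g i1)) (f≈g i2)) (f≈g i3)

  sum4-linear : ∀ f g k → sum4 (λ i → f i + k * g i) ≈ sum4 f + k * sum4 g
  sum4-linear f g k = solve 9
    (λ a b c d e f g h k →
      ((a ⊕ k ⊗ e) ⊕ (b ⊕ k ⊗ f) ⊕ (c ⊕ k ⊗ g) ⊕ (d ⊕ k ⊗ h))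
        ⊜ ((a ⊕ b ⊕ c ⊕ d) ⊕ k ⊗ (e ⊕ f ⊕ g ⊕ h)))
    refl (f i0) (f i1) (f i2) (f i3) (g i0) (g i1) (g i2) (g i3) k

  sum4-scale : ∀ f k → sum4 (λ i → k * f i) ≈ k * sum4 f
  sum4-scale f k = solve 5
    (λ a b c d k → (k ⊗ a ⊕ k ⊗ b ⊕ k ⊗ c ⊕ k ⊗ d) ⊜ k ⊗ (a ⊕ b ⊕ c ⊕ d))
    refl (f i0) (f i1) (f i2) (f i3) k

  Form-linearʳ : ∀ M x y z k → Form M x (λ j → y j + k * z j) ≈ Form M x y + k * Form M x z
  Form-linearʳ M x y z k = begin
    Form M x (λ j → y j + k * z j)
      ≈⟨ sum4-cong (λ i → sum4-cong (λ j → distribute (x i * M i j) (y j) (z j))) ⟩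
    sum4 (λ i → sum4 (λ j → x i * M i j * y j + k * (x i * M i j * z j)))
      ≈⟨ sum4-cong (λ i → sum4-linear (λ j → x i * M i j * y j) (λ j → x i * M i j * z j) k) ⟩
    sum4 (λ i → sum4 (λ j → x i * M i j * y j) + k * sum4 (λ j → x i * M i j * z j))
      ≈⟨ sum4-linear (λ i → sum4 (λ j → x i * M i j * y j)) (λ i → sum4 (λ j → x i * M i j * z j)) k ⟩
    Form M x y + k * Form M x z ∎
    where
    distribute : ∀ a b d → a * (b + k * d) ≈ a * b + k * (a * d)
    distribute a b d = trans (distribˡ a b (k * d)) (+-congˡ (x∙yz≈y∙xz a k d))

  Form-scaleʳ : ∀ M x y z k → (∀ j → y j ≈ k * z j) → Form M x y ≈ k * Form M x z
  Form-scaleʳ M x y z k y≈kz = begin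
    Form M x y
      ≈⟨ sum4-cong (λ i → sum4-cong (λ j → trans (*-congˡ (y≈kz j)) (x∙yz≈y∙xz (x i * M i j) k (z j)))) ⟩
    sum4 (λ i → sum4 (λ j → k * (x i * M i j * z j)))
      ≈⟨ sum4-cong (λ i → sum4-scale (λ j → x i * M i j * z j) k) ⟩
    sum4 (λ i → k * sum4 (λ j → x i * M i j * z j))
      ≈⟨ sum4-scale (λ i → sum4 (λ j → x i * M i j * z j)) k ⟩
    k * Form M x z ∎

  Form-zeroʳ : ∀ M x y → (∀ j → y j ≈ 0#) → Form M x y ≈ 0#
  Form-zeroʳ M x y y≈0 =
    trans (Form-scaleʳ M x y y 0# (λ j → trans (y≈0 j) (sym (zeroˡ (y j))))) (zeroˡ (Form M x y))

  Orthogonal : Mat → V → V → Set ℓ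
  Orthogonal M x y = Form M x y ≈ 0#

  samePolarity-sym : ∀ M₁ M₂ → SamePolarity M₁ M₂ → SamePolarity M₂ M₁
  samePolarity-sym _ _ same x y px py = ⇔-sym (same x y px py)

  module _ (isField : IsField) where

    ∼-sym : ∀ {x y} → x ∼ y → y ∼ x
    ∼-sym {x} {y} (λ' , λ'≉0 , x≈λ'y) with proj₂ isField λ' λ'≉0
    ... | μ , λ'μ≈1 = μ , μ≉0 , y≈μx
      where
      μ≉0 : ¬ (μ ≈ 0#)
      μ≉0 μ≈0 = proj₁ isField (trans (sym (trans (*-congˡ μ≈0) (zeroʳ λ'))) λ'μ≈1)
      y≈μx : ∀ i → y i ≈ μ * x i
      y≈μx i = begin
        y i              ≈⟨ *-identityˡ (y i) ⟨
        1# * y i         ≈⟨ *-congʳ (trans (sym λ'μ≈1) (*-comm λ' μ)) ⟩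
        μ * λ' * y i     ≈⟨ *-assoc μ λ' (y i) ⟩
        μ * (λ' * y i)   ≈⟨ *-congˡ (x≈λ'y i) ⟨
        μ * x i          ∎

    ∼⇒orthogonal : ∀ {M} → IsSymplectic M → ∀ {x y} → x ∼ y → Orthogonal M x y
    ∼⇒orthogonal {M} (alternating , _) {x} {y} x∼y with ∼-sym x∼y
    ... | μ , _ , y≈μx = trans (Form-scaleʳ M x y x μ y≈μx) (trans (*-congˡ (alternating x)) (zeroʳ μ))

    nonorthogonal⇒distinct : ∀ {M} → IsSymplectic M → ∀ {x y} → IsPoint x → ¬ Orthogonal M x y → Distinct x y
    nonorthogonal⇒distinct {M} symplectic {x} {y} px x⊥̸y =
      px , (λ y≈0 → x⊥̸y (Form-zeroʳ M x y y≈0)) , (λ x∼y → x⊥̸y (∼⇒orthogonal {M} symplectic x∼y))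

    module _ (_≈?_ : Decidable _≈_) (M₁ M₂ : Mat) (symplectic₁ : IsSymplectic M₁) where

      orthogonal-on-distinct⇒orthogonal :
        (∀ u v → Distinct u v → Orthogonal M₂ u v → Orthogonal M₁ u v) →
        ∀ x y → IsPoint x → Orthogonal M₂ x y → Orthogonal M₁ x y
      orthogonal-on-distinct⇒orthogonal ⊥₂⇒⊥₁ x y px x⊥₂y =
        decidable-stable (Form M₁ x y ≈? 0#) λ x⊥̸₁y →
          x⊥̸₁y (⊥₂⇒⊥₁ x y (nonorthogonal⇒distinct {M₁} symplectic₁ px x⊥̸₁y) x⊥₂y)

      -- If y ∉ x^ζ₂, every vector is a multiple of y plus a vector of x^ζ₂ ⊆ x^ζ₁, and
      -- y ∈ x^ζ₁; so x^ζ₁ would be the whole space, against the nondegeneracy of ζ₁.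
      orthogonal-⊆⇒⊇ :
        (∀ x y → IsPoint x → Orthogonal M₂ x y → Orthogonal M₁ x y) →
        ∀ x y → IsPoint x → Orthogonal M₁ x y → Orthogonal M₂ x y
      orthogonal-⊆⇒⊇ ⊥₂⇒⊥₁ x y px x⊥₁y =
        decidable-stable (Form M₂ x y ≈? 0#) λ x⊥̸₂y →
          proj₂ symplectic₁ x px (x⊥₁everything x⊥̸₂y)
        where
        x⊥₁everything : ¬ Orthogonal M₂ x y → ∀ z → Orthogonal M₁ x z
        x⊥₁everything x⊥̸₂y z with proj₂ isField (Form M₂ x y) x⊥̸₂y
        ... | β⁻¹ , ββ⁻¹≈1 = begin
          Form M₁ x z                   ≈⟨ +-identityʳ _ ⟨
          Form M₁ x z + 0#              ≈⟨ +-congˡ (trans (*-congˡ x⊥₁y) (zeroʳ t)) ⟨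
          Form M₁ x z + t * Form M₁ x y ≈⟨ Form-linearʳ M₁ x z y t ⟨
          Form M₁ x w                   ≈⟨ ⊥₂⇒⊥₁ x w px x⊥₂w ⟩
          0#                            ∎
          where
          β γ t : Carrier
          β = Form M₂ x y
          γ = Form M₂ x z
          t = - (γ * β⁻¹)
          w : V
          w j = z j + t * y j
          γβ⁻¹β≈γ : γ * β⁻¹ * β ≈ γ
          γβ⁻¹β≈γ = trans (*-assoc γ β⁻¹ β) (trans (*-congˡ (trans (*-comm β⁻¹ β) ββ⁻¹≈1)) (*-identityʳ γ))
          x⊥₂w : Orthogonal M₂ x w
          x⊥₂w = begin
            Form M₂ x w       ≈⟨ Form-linearʳ M₂ x z y t ⟩
            γ + t * β         ≈⟨ +-congˡ (-‿distribˡ-* (γ * β⁻¹) β) ⟨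
            γ - γ * β⁻¹ * β   ≈⟨ +-congˡ (-‿cong γβ⁻¹β≈γ) ⟩
            γ - γ             ≈⟨ -‿inverseʳ γ ⟩
            0#                ∎

      orthogonal-on-distinct⇒samePolarity :
        (∀ u v → Distinct u v → Orthogonal M₂ u v → Orthogonal M₁ u v) → SamePolarity M₁ M₂
      orthogonal-on-distinct⇒samePolarity ⊥₂⇒⊥₁ x y px _ =
        mk⇔ (orthogonal-⊆⇒⊇ ⊥₂⇒⊥₁′ x y px) (⊥₂⇒⊥₁′ x y px)
        where ⊥₂⇒⊥₁′ = orthogonal-on-distinct⇒orthogonal ⊥₂⇒⊥₁

  module _ (O₁ O₂ : PointSet) (M₁ M₂ : Mat) (polarity₁ : PolarityOf M₁ O₁) (polarity₂ : PolarityOf M₂ O₂) where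
    open Equivalence

    samePolarity⇒sameGQ : SamePolarity M₁ M₂ → SameGQ O₁ O₂
    samePolarity⇒sameGQ same u v d@(pu , pv , _) = mk⇔
      (to (polarity₂ u v d) ∘ to (same u v pu pv) ∘ from (polarity₁ u v d))
      (to (polarity₁ u v d) ∘ from (same u v pu pv) ∘ from (polarity₂ u v d))

    ovoidOfGQ⇔samePolarity : IsField → Decidable _≈_ → IsSymplectic M₁ →
      IsOvoidOfGQ O₁ O₂ ⇔ SamePolarity M₁ M₂
    ovoidOfGQ⇔samePolarity isField _≈?_ symplectic₁ = mk⇔
      (λ ovoid → orthogonal-on-distinct⇒samePolarity isField _≈?_ M₁ M₂ symplectic₁
        λ u v d → from (polarity₁ u v d) ∘ ovoid u v d ∘ to (polarity₂ u v d))
      (λ same u v d → from (samePolarity⇒sameGQ same u v d))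

  sameGQ⇒ovoidOfGQ : ∀ O₁ O₂ → SameGQ O₁ O₂ → IsOvoidOfGQ O₁ O₂
  sameGQ⇒ovoidOfGQ _ _ same u v d = Equivalence.from (same u v d)

lemma4p7 : {c ℓ : Level} (R : CommutativeRing c ℓ) (q : ℕ) →
    let open PG R in
    IsField → HasOrder q → 2 ∣ q →
    (O₁ O₂ : PointSet) → RespectsProj O₁ → RespectsProj O₂ →
    IsOvoidPG q O₁ → IsOvoidPG q O₂ →
    (M₁ M₂ : Mat) →
    IsSymplectic M₁ → IsSymplectic M₂ →
    PolarityOf M₁ O₁ → PolarityOf M₂ O₂ →
    (SamePolarity M₁ M₂ ⇔ SameGQ O₁ O₂)
    × (SameGQ O₁ O₂ ⇔ IsOvoidOfGQ O₁ O₂)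
    × (IsOvoidOfGQ O₁ O₂ ⇔ IsOvoidOfGQ O₂ O₁)
lemma4p7 R q isField hasOrder _ O₁ O₂ _ _ _ _ M₁ M₂ symplectic₁ symplectic₂ polarity₁ polarity₂ =
    mk⇔ samePolarity⇒sameGQ₁₂ (to ovoid₁₂ ∘ sameGQ⇒ovoidOfGQ R O₁ O₂)
  , mk⇔ (sameGQ⇒ovoidOfGQ R O₁ O₂) (samePolarity⇒sameGQ₁₂ ∘ to ovoid₁₂)
  , mk⇔ (from ovoid₂₁ ∘ samePolarity-sym R M₁ M₂ ∘ to ovoid₁₂)
        (from ovoid₁₂ ∘ samePolarity-sym R M₂ M₁ ∘ to ovoid₂₁)
  where
  open PG R
  open Equivalence
  samePolarity⇒sameGQ₁₂ : SamePolarity M₁ M₂ → SameGQ O₁ O₂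
  samePolarity⇒sameGQ₁₂ = samePolarity⇒sameGQ R O₁ O₂ M₁ M₂ polarity₁ polarity₂
  ovoid₁₂ : IsOvoidOfGQ O₁ O₂ ⇔ SamePolarity M₁ M₂
  ovoid₁₂ = ovoidOfGQ⇔samePolarity R O₁ O₂ M₁ M₂ polarity₁ polarity₂ isField (hasOrder⇒≈-dec R hasOrder) symplectic₁
  ovoid₂₁ : IsOvoidOfGQ O₂ O₁ ⇔ SamePolarity M₂ M₁
  ovoid₂₁ = ovoidOfGQ⇔samePolarity R O₂ O₁ M₂ M₁ polarity₂ polarity₁ isField (hasOrder⇒≈-dec R hasOrder) symplectic₂
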